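{- Let $M$ be an $n\times n$ dissimilarity matrix with entries in $\{0,1\}$, and let $r$ be the minimal number of graphs in a cover of $G_M$ by cliques and star trees in which every edge of $G_M$ (but not necessarily every vertex) lies in some member of the cover. Then $M$ has star tree rank $r$ or $r+1$. Moreover, if $G_M$ has a solid cover by $r$ graphs, then $M$ has star tree rank $r$.
   Context: An $n\times n$ dissimilarity matrix is a function from 2-element subsets of $[n]$ to $\mathbb{R}$. A star tree matrix is one of the form $(v_i+v_j)_{i\ne j}$ for $v\in\mathbb{R}^n$; the star tree rank of $M$ is the least $r$ such that $M$ is the entrywise minimum of $r$ star tree matrices. $G_M$ is the graph on $[n]$ whose edges are the pairs $\{i,j\}$ with $M_{ij}=0$. A clique is a complete subgraph; a star tree is a subgraph consisting of a central vertex together with edges from it to each vertex of some set of other vertices (its leaves). A cover of $G_M$ by cliques and star trees (each a subgraph of $G_M$) is solid if for every pair of distinct vertices $i,j$ at least one holds: (1) $\{i,j\}$ is an edge of $G_M$; (2) $i$ or $j$ belongs to a clique in the cover; (3) $i$ or $j$ is the center of a star tree in the cover; (4) $i$ and $j$ are both leaves of the same star tree in the cover.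
   Formalization: The vectors $v$ defining star tree matrices, and hence the star tree rank, are taken over ℚ instead of ℝ. -}

module Defs where

open import Data.Nat using (ℕ; suc) renaming (_≤_ to _≤ℕ_)
open import Data.Fin using (Fin)
open import Data.Fin.Subset using (Subset; _∈_; _∉_)
open import Data.Rational using (ℚ; 0ℚ; 1ℚ; _+_; _≤_)
open import Data.Product using (Σ; _×_; ∃; ∃-syntax)
open import Data.Sum using (_⊎_)
open import Data.Empty using (⊥)
open import Relation.Binary.PropositionalEquality using (_≡_; _≢_)

-- A dissimilarity matrix is represented by a symmetric function on
-- pairs of indices; diagonal entries are ignored everywhere.
Matrix : ℕ → Set
Matrix n = Fin n → Fin n → ℚ

IsSymmetric : {n : ℕ} → Matrix n → Set
IsSymmetric {n} M = ∀ (i j : Fin n) → i ≢ j → M i j ≡ M j i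

IsZeroOne : {n : ℕ} → Matrix n → Set
IsZeroOne {n} M = ∀ (i j : Fin n) → i ≢ j → (M i j ≡ 0ℚ) ⊎ (M i j ≡ 1ℚ)

-- M is the entrywise minimum of the r star tree matrices (v_k i + v_k j):
-- for every pair i ≠ j, each star tree entry is ≥ M i j and one attains it.
IsMinOfStarTrees : {n : ℕ} → Matrix n → (r : ℕ) → (Fin r → Fin n → ℚ) → Set
IsMinOfStarTrees {n} M r vs =
  ∀ (i j : Fin n) → i ≢ j →
    (∀ (k : Fin r) → M i j ≤ vs k i + vs k j) ×
    (∃[ k ] (M i j ≡ vs k i + vs k j))

IsStarMin : {n : ℕ} → Matrix n → ℕ → Set
IsStarMin {n} M r = ∃[ vs ] IsMinOfStarTrees {n} M r vs

StarTreeRank : {n : ℕ} → Matrix n → ℕ → Set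
StarTreeRank M r = IsStarMin M r × (∀ (r' : ℕ) → IsStarMin M r' → r ≤ℕ r')

Edge : {n : ℕ} → Matrix n → Fin n → Fin n → Set
Edge M i j = (i ≢ j) × (M i j ≡ 0ℚ)

data Member (n : ℕ) : Set where
  clique : Subset n → Member n
  star   : Fin n → Subset n → Member n

ValidMember : {n : ℕ} → Matrix n → Member n → Set
ValidMember {n} M (clique C) =
  ∀ (i j : Fin n) → i ∈ C → j ∈ C → i ≢ j → Edge M i j
ValidMember {n} M (star c L) = (c ∉ L) × (∀ (l : Fin n) → l ∈ L → Edge M c l)

CoversEdge : {n : ℕ} → Member n → Fin n → Fin n → Set
CoversEdge (clique C) i j = (i ∈ C) × (j ∈ C)
CoversEdge (star c L) i j = ((i ≡ c) × (j ∈ L)) ⊎ ((j ≡ c) × (i ∈ L))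

EdgeCover : {n : ℕ} → Matrix n → (r : ℕ) → (Fin r → Member n) → Set
EdgeCover {n} M r F =
  (∀ (k : Fin r) → ValidMember M (F k)) ×
  (∀ (i j : Fin n) → Edge M i j → ∃[ k ] CoversEdge (F k) i j)

MinCoverNumber : {n : ℕ} → Matrix n → ℕ → Set
MinCoverNumber {n} M r =
  (∃[ F ] EdgeCover M r F) ×
  (∀ (r' : ℕ) (F : Fin r' → Member n) → EdgeCover M r' F → r ≤ℕ r')

InClique : {n : ℕ} → Member n → Fin n → Set
InClique (clique C) i = i ∈ C
InClique (star c L) i = ⊥

IsCenter : {n : ℕ} → Member n → Fin n → Set
IsCenter (clique C) i = ⊥
IsCenter (star c L) i = i ≡ c

BothLeaves : {n : ℕ} → Member n → Fin n → Fin n → Set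
BothLeaves (clique C) i j = ⊥
BothLeaves (star c L) i j = (i ∈ L) × (j ∈ L)

IsSolid : {n : ℕ} → Matrix n → (r : ℕ) → (Fin r → Member n) → Set
IsSolid {n} M r F =
  ∀ (i j : Fin n) → i ≢ j →
    Edge M i j
    ⊎ (∃[ k ] (InClique (F k) i ⊎ InClique (F k) j))
    ⊎ (∃[ k ] (IsCenter (F k) i ⊎ IsCenter (F k) j))
    ⊎ (∃[ k ] BothLeaves (F k) i j)

{-# OPTIONS --safe #-}
-- A vector v is feasible if v i + v j ≥ M i j for all pairs, and tight at a pair if equality
-- holds. If a feasible v has a negative entry v c, every other entry exceeds - v c, so v is
-- tight at 0 only on pairs {c, l} with v l = - v c: a star tree of G_M. Otherwise v is tight
-- at 0 exactly on pairs of zeros of v: a clique. Hence star tree rank r' gives a cover of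
-- G_M by r' members, so the rank is at least r. Conversely a clique C gives the feasible
-- vector 0 on C, 1 off C, and a star tree the vector -1/2, 1/2, 3/2 on center, leaves and
-- other vertices; they are tight at 0 on the covered edges. Adding the constant 1/2, which
-- is tight on every non-edge, shows rank ≤ r + 1; for a solid cover the member vectors are
-- already tight on all non-edges, so the rank is r.
--
-- Choosing between r and r + 1 constructively needs a decision procedure for rank ≤ r. Any
-- feasible vector can be replaced, keeping all its tight pairs, first by one with values
-- in [-1, 2] (shift weight onto an entry below -1, then cap at 2), then by rounding each
-- value v to a half-integer (integers stay, other values go to the midpoint of their unit
-- interval), since this preserves how a sum of two entries compares with an integer. So
-- it suffices to search the finitely many vectors with values in a grid of half-integers.
module Submission where

open import Defs
open import Data.Nat as ℕ using (ℕ; zero; suc; z≤n; s≤s)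
import Data.Nat.Properties as ℕ
open import Data.Nat.Tactic.RingSolver using (solve-∀)
open import Data.Rational using (ℚ; 0ℚ; 1ℚ; ½; _+_; _-_; -_; _*_; _⊓_; _≤_; _≰_; _<_)
open import Data.Rational.Properties
open import Data.Fin as Fin using (Fin; toℕ; fromℕ<; finToFun; funToFin) renaming (_≟_ to _≟ᶠ_)
open import Data.Fin.Properties using (any?; all?; finToFun-funToFin; toℕ-fromℕ<)
open import Data.Fin.Subset using (Subset; _∈_; _∉_)
open import Data.Fin.Subset.Properties using (_∈?_)
open import Data.Vec using (tabulate)
open import Data.Vec.Properties using (lookup∘tabulate; lookup⇒[]=; []=⇒lookup)
open import Data.Product using (_×_; _,_; proj₁; proj₂; ∃; ∃-syntax)
open import Data.Sum using (_⊎_; inj₁; inj₂)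
open import Data.Empty using (⊥-elim)
open import Function using (_∘_)
open import Relation.Nullary using (Dec; yes; no; does)
open import Relation.Nullary.Decidable using (from-yes; dec-true; ¬?; _×-dec_; _→-dec_)
open import Relation.Unary using (Decidable)
open import Relation.Binary.PropositionalEquality
open import Algebra.Properties.Group +-0-group using (//-rightDividesʳ)
open import Algebra.Properties.AbelianGroup +-0-abelianGroup using (xyx⁻¹≈y)
open import Data.Rational.Solver using (module +-*-Solver)
open +-*-Solver using (solve; _:+_; _:*_; :-_; _:-_; con; _:=_)

p<p+1 : ∀ p → p < p + 1ℚ
p<p+1 p = subst (_< p + 1ℚ) (+-identityʳ p) (+-monoʳ-< p (positive⁻¹ 1ℚ))

+-cancelʳ-≤ : ∀ c {x y} → x + c ≤ y + c → x ≤ y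
+-cancelʳ-≤ c {x} {y} x+c≤y+c =
  subst₂ _≤_ (//-rightDividesʳ c x) (//-rightDividesʳ c y) (+-monoˡ-≤ (- c) x+c≤y+c)

+-cancelʳ-≡ : ∀ c {x y} → x + c ≡ y + c → x ≡ y
+-cancelʳ-≡ c {x} {y} x+c≡y+c =
  trans (sym (//-rightDividesʳ c x)) (trans (cong (_+ - c) x+c≡y+c) (//-rightDividesʳ c y))

0≤p+q⇒-q≤p : ∀ p q → 0ℚ ≤ p + q → - q ≤ p
0≤p+q⇒-q≤p p q 0≤p+q = subst₂ _≤_ (+-identityˡ (- q)) (//-rightDividesʳ q p) (+-monoˡ-≤ (- q) 0≤p+q)

p+q≡0⇒q≡-p : ∀ p q → p + q ≡ 0ℚ → q ≡ - p
p+q≡0⇒q≡-p p q p+q≡0 = trans (sym (xyx⁻¹≈y p q)) (trans (cong (_+ - p) p+q≡0) (+-identityˡ (- p)))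

nonNeg-+-≡0⇒≡0 : ∀ {p q} → 0ℚ ≤ p → 0ℚ ≤ q → p + q ≡ 0ℚ → p ≡ 0ℚ
nonNeg-+-≡0⇒≡0 {p} {q} 0≤p 0≤q p+q≡0 =
  ≤-antisym (subst₂ _≤_ (+-identityʳ p) p+q≡0 (+-monoʳ-≤ p 0≤q)) 0≤p

fromℕ : ℕ → ℚ
fromℕ zero    = 0ℚ
fromℕ (suc k) = fromℕ k + 1ℚ

fromℕ-+ : ∀ a b → fromℕ (a ℕ.+ b) ≡ fromℕ a + fromℕ b
fromℕ-+ zero    b = sym (+-identityˡ (fromℕ b))
fromℕ-+ (suc a) b = trans (cong (_+ 1ℚ) (fromℕ-+ a b)) (shuffle (fromℕ a) (fromℕ b))
  where
  shuffle : ∀ x y → (x + y) + 1ℚ ≡ (x + 1ℚ) + y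
  shuffle = solve 2 (λ x y → (x :+ y) :+ con 1ℚ := (x :+ con 1ℚ) :+ y) refl

fromℕ-mono-≤ : ∀ {a b} → a ℕ.≤ b → fromℕ a ≤ fromℕ b
fromℕ-mono-≤ {b = zero}  z≤n     = ≤-refl
fromℕ-mono-≤ {b = suc b} z≤n     = ≤-trans (fromℕ-mono-≤ {b = b} z≤n) (<⇒≤ (p<p+1 (fromℕ b)))
fromℕ-mono-≤             (s≤s h) = +-monoˡ-≤ 1ℚ (fromℕ-mono-≤ h)

fromℕ-cancel-< : ∀ {a b} → fromℕ a < fromℕ b → a ℕ.< b
fromℕ-cancel-< a<b = ℕ.≰⇒> (λ b≤a → <-irrefl refl (<-≤-trans a<b (fromℕ-mono-≤ b≤a)))

fromℕ-cancel-≤ : ∀ {a b} → fromℕ a ≤ fromℕ b → a ℕ.≤ b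
fromℕ-cancel-≤ {a} {b} a≤b = ℕ.≤-pred (fromℕ-cancel-< {a} {suc b} (≤-<-trans a≤b (p<p+1 (fromℕ b))))

-- z counts halves: z / 2 is the rounding of s.
data HalfRounding (s : ℚ) : ℕ → Set where
  exact   : ∀ k → s ≡ fromℕ k → HalfRounding s (2 ℕ.* k)
  between : ∀ k → fromℕ k < s → s < fromℕ (suc k) → HalfRounding s (suc (2 ℕ.* k))

half : ℕ → ℚ
half z = fromℕ z * ½

half-+ : ∀ a b → half (a ℕ.+ b) ≡ half a + half b
half-+ a b = trans (cong (_* ½) (fromℕ-+ a b)) (*-distribʳ-+ ½ (fromℕ a) (fromℕ b))

half-double : ∀ d → half (2 ℕ.* d) ≡ fromℕ d
half-double d =
  trans (half-+ d (d ℕ.+ 0)) (trans (cong (λ e → half d + half e) (ℕ.+-identityʳ d)) (halves (fromℕ d)))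
  where
  halves : ∀ x → x * ½ + x * ½ ≡ x
  halves = solve 1 (λ x → x :* con ½ :+ x :* con ½ := x) refl

floor : ∀ N {s} → 0ℚ ≤ s → s < fromℕ N → ∃[ k ] (fromℕ k ≤ s × s < fromℕ (suc k))
floor zero    0≤s s<0 = ⊥-elim (<-irrefl refl (<-≤-trans s<0 0≤s))
floor (suc N) {s} 0≤s s<N+1 with s <? fromℕ N
... | yes s<N = floor N 0≤s s<N
... | no  s≮N = N , ≮⇒≥ s≮N , s<N+1

halfRounding : ∀ N {s} → 0ℚ ≤ s → s < fromℕ N → ∃[ z ] (z ℕ.< 2 ℕ.* N × HalfRounding s z)
halfRounding N {s} 0≤s s<N with floor N 0≤s s<N
... | k , k≤s , s<k+1 = round (fromℕ k <? s)
  where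
  k<N : k ℕ.< N
  k<N = fromℕ-cancel-< {k} {N} (≤-<-trans k≤s s<N)
  round : Dec (fromℕ k < s) → ∃[ z ] (z ℕ.< 2 ℕ.* N × HalfRounding s z)
  round (yes k<s) = suc (2 ℕ.* k) , subst (ℕ._≤ 2 ℕ.* N) (ℕ.*-suc 2 k) (ℕ.*-monoʳ-≤ 2 k<N) ,
                    between k k<s s<k+1
  round (no k≮s)  = 2 ℕ.* k , ℕ.*-monoʳ-< 2 k<N , exact k (≤-antisym (≮⇒≥ k≮s) k≤s)

fromℕ-<-+ : ∀ {x} D a b → fromℕ D ≤ x → x < fromℕ a + fromℕ b → D ℕ.< a ℕ.+ b
fromℕ-<-+ D a b D≤x x<a+b =
  fromℕ-cancel-< {D} {a ℕ.+ b} (≤-<-trans D≤x (subst (_ <_) (sym (fromℕ-+ a b)) x<a+b))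

fromℕ-+-< : ∀ {x} a b D → fromℕ a + fromℕ b < x → x ≤ fromℕ D → a ℕ.+ b ℕ.< D
fromℕ-+-< a b D a+b<x x≤D =
  fromℕ-cancel-< {a ℕ.+ b} {D} (<-≤-trans (subst (_< _) (sym (fromℕ-+ a b)) a+b<x) x≤D)

double-pred : ∀ {D} k l → D ℕ.< k ℕ.+ suc l → 2 ℕ.* D ℕ.≤ 2 ℕ.* k ℕ.+ 2 ℕ.* l
double-pred {D} k l D<k+l+1 =
  subst (2 ℕ.* D ℕ.≤_) (ℕ.*-distribˡ-+ 2 k l)
    (ℕ.*-monoʳ-≤ 2 (ℕ.≤-pred (subst (D ℕ.<_) (ℕ.+-suc k l) D<k+l+1)))

double-suc : ∀ k l → 2 ℕ.* suc (k ℕ.+ l) ≡ suc (2 ℕ.* k) ℕ.+ suc (2 ℕ.* l)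
double-suc = solve-∀

halfRounding-exact-between-≥ : ∀ {t} D k l → t < fromℕ (suc l) → fromℕ D ≤ fromℕ k + t →
                2 ℕ.* D ℕ.≤ 2 ℕ.* k ℕ.+ suc (2 ℕ.* l)
halfRounding-exact-between-≥ D k l t<l+1 D≤ =
  ℕ.≤-trans (double-pred k l (fromℕ-<-+ D k (suc l) D≤ (+-monoʳ-< (fromℕ k) t<l+1)))
    (ℕ.+-monoʳ-≤ (2 ℕ.* k) (ℕ.n≤1+n _))

halfRounding-sum-≥ : ∀ {s t z z'} D → HalfRounding s z → HalfRounding t z' →
                   fromℕ D ≤ s + t → 2 ℕ.* D ℕ.≤ z ℕ.+ z'
halfRounding-sum-≥ D (exact k refl) (exact l refl) D≤ =
  double-pred k l (fromℕ-<-+ D k (suc l) D≤ (+-monoʳ-< (fromℕ k) (p<p+1 (fromℕ l))))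
halfRounding-sum-≥ D (exact k refl) (between l _ t<l+1) D≤ =
  halfRounding-exact-between-≥ D k l t<l+1 D≤
halfRounding-sum-≥ {s} {t} D (between k _ s<k+1) (exact l refl) D≤ =
  subst (2 ℕ.* D ℕ.≤_) (ℕ.+-comm (2 ℕ.* l) _)
    (halfRounding-exact-between-≥ D l k s<k+1 (subst (fromℕ D ≤_) (+-comm s t) D≤))
halfRounding-sum-≥ D (between k _ s<k+1) (between l _ t<l+1) D≤ =
  subst (2 ℕ.* D ℕ.≤_) (double-suc k l)
    (ℕ.*-monoʳ-≤ 2 (subst (D ℕ.≤_) (ℕ.+-suc k l)
      (ℕ.≤-pred (fromℕ-<-+ D (suc k) (suc l) D≤ (+-mono-< s<k+1 t<l+1)))))

halfRounding-halfRounding-exact-between-≥-≤ : ∀ {t} D k l → fromℕ l < t → fromℕ k + t ≤ fromℕ D →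
                  2 ℕ.* k ℕ.+ suc (2 ℕ.* l) ℕ.≤ 2 ℕ.* D
halfRounding-halfRounding-exact-between-≥-≤ D k l l<t ≤D =
  ℕ.≤-trans (subst (2 ℕ.* k ℕ.+ suc (2 ℕ.* l) ℕ.≤_) (double-suc-pred k l) (ℕ.n≤1+n _))
    (ℕ.*-monoʳ-≤ 2 (fromℕ-+-< k l D (+-monoʳ-< (fromℕ k) l<t) ≤D))
  where
  double-suc-pred : ∀ k l → suc (2 ℕ.* k ℕ.+ suc (2 ℕ.* l)) ≡ 2 ℕ.* suc (k ℕ.+ l)
  double-suc-pred = solve-∀

halfRounding-sum-≤ : ∀ {s t z z'} D → HalfRounding s z → HalfRounding t z' →
                   s + t ≤ fromℕ D → z ℕ.+ z' ℕ.≤ 2 ℕ.* D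
halfRounding-sum-≤ D (exact k refl) (exact l refl) ≤D =
  subst (ℕ._≤ 2 ℕ.* D) (ℕ.*-distribˡ-+ 2 k l)
    (ℕ.*-monoʳ-≤ 2 (fromℕ-cancel-≤ {k ℕ.+ l} {D} (subst (_≤ fromℕ D) (sym (fromℕ-+ k l)) ≤D)))
halfRounding-sum-≤ D (exact k refl) (between l l<t _) ≤D = halfRounding-halfRounding-exact-between-≥-≤ D k l l<t ≤D
halfRounding-sum-≤ {s} {t} D (between k k<s _) (exact l refl) ≤D =
  subst (ℕ._≤ 2 ℕ.* D) (ℕ.+-comm (2 ℕ.* l) _)
    (halfRounding-halfRounding-exact-between-≥-≤ D l k k<s (subst (_≤ fromℕ D) (+-comm s t) ≤D))
halfRounding-sum-≤ D (between k k<s _) (between l l<t _) ≤D =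
  subst (ℕ._≤ 2 ℕ.* D) (double-suc k l)
    (ℕ.*-monoʳ-≤ 2 (fromℕ-+-< k l D (+-mono-< k<s l<t) ≤D))

half-mono-≤ : ∀ {a b} → a ℕ.≤ b → half a ≤ half b
half-mono-≤ a≤b = *-monoʳ-≤-nonNeg ½ (fromℕ-mono-≤ a≤b)

halfRounding-half-≥ : ∀ {s t z z'} D → HalfRounding s z → HalfRounding t z' →
                         fromℕ D ≤ s + t → fromℕ D ≤ half z + half z'
halfRounding-half-≥ {z = z} {z'} D r r' D≤ = begin
  fromℕ D           ≡⟨ half-double D ⟨
  half (2 ℕ.* D)    ≤⟨ half-mono-≤ (halfRounding-sum-≥ D r r' D≤) ⟩
  half (z ℕ.+ z')   ≡⟨ half-+ z z' ⟩
  half z + half z'  ∎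
  where open ≤-Reasoning

halfRounding-half-≡ : ∀ {s t z z'} D → HalfRounding s z → HalfRounding t z' →
                         s + t ≡ fromℕ D → half z + half z' ≡ fromℕ D
halfRounding-half-≡ {z = z} {z'} D r r' s+t≡D = begin
  half z + half z'  ≡⟨ half-+ z z' ⟨
  half (z ℕ.+ z')   ≡⟨ cong half z+z'≡2D ⟩
  half (2 ℕ.* D)    ≡⟨ half-double D ⟩
  fromℕ D           ∎
  where
  open ≡-Reasoning
  z+z'≡2D : z ℕ.+ z' ≡ 2 ℕ.* D
  z+z'≡2D = ℕ.≤-antisym (halfRounding-sum-≤ D r r' (≤-reflexive s+t≡D))
                        (halfRounding-sum-≥ D r r' (≤-reflexive (sym s+t≡D)))

anyFunction? : ∀ {m k} {P : (Fin m → Fin k) → Set} → (∀ f → Dec (P f)) →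
               (∀ {f g} → f ≗ g → P f → P g) → Dec (∃ P)
anyFunction? {m} {k} P? resp with any? (P? ∘ finToFun {k} {m})
... | yes (c , p) = yes (_ , p)
... | no ¬p = no λ (f , pf) → ¬p (funToFin f , resp (sym ∘ finToFun-funToFin f) pf)

subsetOf : ∀ {n} {P : Fin n → Set} → Decidable P → Subset n
subsetOf P? = tabulate (does ∘ P?)

∈-subsetOf⁻ : ∀ {n} {P : Fin n → Set} (P? : Decidable P) {i} → i ∈ subsetOf P? → P i
∈-subsetOf⁻ P? {i} i∈ with P? i | trans (sym (lookup∘tabulate (does ∘ P?) i)) ([]=⇒lookup i∈)
... | yes p | _ = p
... | no _  | ()

∈-subsetOf⁺ : ∀ {n} {P : Fin n → Set} (P? : Decidable P) {i} → P i → i ∈ subsetOf P?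
∈-subsetOf⁺ P? {i} p = lookup⇒[]= i _ (trans (lookup∘tabulate (does ∘ P?) i) (dec-true (P? i) p))

data StarRole {n} (c : Fin n) (L : Subset n) (i : Fin n) : Set where
  center : i ≡ c → StarRole c L i
  leaf   : i ≢ c → i ∈ L → StarRole c L i
  other  : i ≢ c → i ∉ L → StarRole c L i

starRole : ∀ {n} (c : Fin n) L i → StarRole c L i
starRole c L i with i ≟ᶠ c | i ∈? L
... | yes i≡c | _     = center i≡c
... | no  i≢c | yes l = leaf i≢c l
... | no  i≢c | no ¬l = other i≢c ¬l

starValue : ∀ {n} {c : Fin n} {L i} → StarRole c L i → ℚ
starValue (center _)  = - ½
starValue (leaf _ _)  = ½
starValue (other _ _) = 1ℚ + ½

cliqueValue : ∀ {A : Set} → Dec A → ℚ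
cliqueValue (yes _) = 0ℚ
cliqueValue (no _)  = 1ℚ

memberVec : ∀ {n} → Member n → Fin n → ℚ
memberVec (clique C) i = cliqueValue (i ∈? C)
memberVec (star c L) i = starValue (starRole c L i)

module _ {n} {c : Fin n} {L : Subset n} {i : Fin n} where

  starVec-center : i ≡ c → memberVec (star c L) i ≡ - ½
  starVec-center i≡c with starRole c L i
  ... | center _    = refl
  ... | leaf i≢c _  = ⊥-elim (i≢c i≡c)
  ... | other i≢c _ = ⊥-elim (i≢c i≡c)

  starVec-leaf : i ≢ c → i ∈ L → memberVec (star c L) i ≡ ½
  starVec-leaf i≢c i∈L with starRole c L i
  ... | center i≡c  = ⊥-elim (i≢c i≡c)
  ... | leaf _ _    = refl
  ... | other _ i∉L = ⊥-elim (i∉L i∈L)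

cliqueVec-in : ∀ {n} {C : Subset n} {i} → i ∈ C → memberVec (clique C) i ≡ 0ℚ
cliqueVec-in {C = C} {i} i∈C with i ∈? C
... | yes _   = refl
... | no i∉C  = ⊥-elim (i∉C i∈C)

Solidifies : ∀ {n} → Member n → Fin n → Fin n → Set
Solidifies m i j = (InClique m i ⊎ InClique m j) ⊎ (IsCenter m i ⊎ IsCenter m j) ⊎ BothLeaves m i j

solidAt : ∀ {n r} {M : Matrix n} {F : Fin r → Member n} {i j} → IsSolid M r F → i ≢ j →
          Edge M i j ⊎ ∃[ k ] Solidifies (F k) i j
solidAt {i = i} {j} solid i≢j with solid i j i≢j
... | inj₁ edge                    = inj₁ edge
... | inj₂ (inj₁ (k , inClique))   = inj₂ (k , inj₁ inClique)
... | inj₂ (inj₂ (inj₁ (k , ctr))) = inj₂ (k , inj₂ (inj₁ ctr))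
... | inj₂ (inj₂ (inj₂ (k , lvs))) = inj₂ (k , inj₂ (inj₂ lvs))

module _ {n} {i j : Fin n} (i≢j : i ≢ j) where

  memberVec-covers : ∀ m → CoversEdge m i j → memberVec m i + memberVec m j ≡ 0ℚ
  memberVec-covers (clique C) (i∈C , j∈C) = cong₂ _+_ (cliqueVec-in i∈C) (cliqueVec-in j∈C)
  memberVec-covers (star c L) (inj₁ (i≡c , j∈L)) =
    cong₂ _+_ (starVec-center i≡c) (starVec-leaf (λ j≡c → i≢j (trans i≡c (sym j≡c))) j∈L)
  memberVec-covers (star c L) (inj₂ (j≡c , i∈L)) =
    cong₂ _+_ (starVec-leaf (λ i≡c → i≢j (trans i≡c (sym j≡c))) i∈L) (starVec-center j≡c)

  memberVec-≥1 : ∀ m → CoversEdge m i j ⊎ 1ℚ ≤ memberVec m i + memberVec m j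
  memberVec-≥1 (clique C) with i ∈? C | j ∈? C
  ... | yes i∈C | yes j∈C = inj₁ (i∈C , j∈C)
  ... | yes _   | no _    = inj₂ (from-yes (1ℚ ≤? 0ℚ + 1ℚ))
  ... | no _    | yes _   = inj₂ (from-yes (1ℚ ≤? 1ℚ + 0ℚ))
  ... | no _    | no _    = inj₂ (from-yes (1ℚ ≤? 1ℚ + 1ℚ))
  memberVec-≥1 (star c L) with starRole c L i | starRole c L j
  ... | center i≡c | center j≡c = ⊥-elim (i≢j (trans i≡c (sym j≡c)))
  ... | center i≡c | leaf _ j∈L = inj₁ (inj₁ (i≡c , j∈L))
  ... | leaf _ i∈L | center j≡c = inj₁ (inj₂ (j≡c , i∈L))
  ... | center _   | other _ _  = inj₂ (from-yes (1ℚ ≤? - ½ + (1ℚ + ½)))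
  ... | leaf _ _   | leaf _ _   = inj₂ (from-yes (1ℚ ≤? ½ + ½))
  ... | leaf _ _   | other _ _  = inj₂ (from-yes (1ℚ ≤? ½ + (1ℚ + ½)))
  ... | other _ _  | center _   = inj₂ (from-yes (1ℚ ≤? (1ℚ + ½) + - ½))
  ... | other _ _  | leaf _ _   = inj₂ (from-yes (1ℚ ≤? (1ℚ + ½) + ½))
  ... | other _ _  | other _ _  = inj₂ (from-yes (1ℚ ≤? (1ℚ + ½) + (1ℚ + ½)))

  memberVec-solid : ∀ m → Solidifies m i j → CoversEdge m i j ⊎ memberVec m i + memberVec m j ≡ 1ℚ
  memberVec-solid (clique C) (inj₁ (inj₁ i∈C)) with j ∈? C
  ... | yes j∈C = inj₁ (i∈C , j∈C)
  ... | no _    = inj₂ (cong (_+ 1ℚ) (cliqueVec-in i∈C))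
  memberVec-solid (clique C) (inj₁ (inj₂ j∈C)) with i ∈? C
  ... | yes i∈C = inj₁ (i∈C , j∈C)
  ... | no _    = inj₂ (cong (1ℚ +_) (cliqueVec-in j∈C))
  memberVec-solid (clique C) (inj₂ (inj₁ (inj₁ ())))
  memberVec-solid (clique C) (inj₂ (inj₁ (inj₂ ())))
  memberVec-solid (clique C) (inj₂ (inj₂ ()))
  memberVec-solid (star c L) (inj₁ (inj₁ ()))
  memberVec-solid (star c L) (inj₁ (inj₂ ()))
  memberVec-solid (star c L) (inj₂ (inj₁ (inj₁ i≡c))) with starRole c L j
  ... | center j≡c = ⊥-elim (i≢j (trans i≡c (sym j≡c)))
  ... | leaf _ j∈L = inj₁ (inj₁ (i≡c , j∈L))
  ... | other _ _  = inj₂ (cong (_+ (1ℚ + ½)) (starVec-center i≡c))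
  memberVec-solid (star c L) (inj₂ (inj₁ (inj₂ j≡c))) with starRole c L i
  ... | center i≡c = ⊥-elim (i≢j (trans i≡c (sym j≡c)))
  ... | leaf _ i∈L = inj₁ (inj₂ (j≡c , i∈L))
  ... | other _ _  = inj₂ (cong ((1ℚ + ½) +_) (starVec-center j≡c))
  memberVec-solid (star c L) (inj₂ (inj₂ (i∈L , j∈L))) = leaves (i ≟ᶠ c) (j ≟ᶠ c)
    where
    leaves : Dec (i ≡ c) → Dec (j ≡ c) →
             CoversEdge (star c L) i j ⊎ memberVec (star c L) i + memberVec (star c L) j ≡ 1ℚ
    leaves (yes i≡c) _         = inj₁ (inj₁ (i≡c , j∈L))
    leaves (no _)    (yes j≡c) = inj₁ (inj₂ (j≡c , i∈L))
    leaves (no i≢c)  (no j≢c)  = inj₂ (cong₂ _+_ (starVec-leaf i≢c i∈L) (starVec-leaf j≢c j∈L))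

x+y+2≡[x+1]+[y+1] : ∀ x y → (x + y) + (1ℚ + 1ℚ) ≡ (x + 1ℚ) + (y + 1ℚ)
x+y+2≡[x+1]+[y+1] = solve 2 (λ x y → (x :+ y) :+ (con 1ℚ :+ con 1ℚ) := (x :+ con 1ℚ) :+ (y :+ con 1ℚ)) refl

[a-1]+[b-1]+2≡a+b : ∀ a b → ((a - 1ℚ) + (b - 1ℚ)) + (1ℚ + 1ℚ) ≡ a + b
[a-1]+[b-1]+2≡a+b = solve 2 (λ a b → ((a :- con 1ℚ) :+ (b :- con 1ℚ)) :+ (con 1ℚ :+ con 1ℚ) := a :+ b) refl

rounding-keeps-≤ : ∀ {z z'} c x y → ∃[ D ] c + (1ℚ + 1ℚ) ≡ fromℕ D →
                   HalfRounding (x + 1ℚ) z → HalfRounding (y + 1ℚ) z' →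
                   c ≤ x + y → c ≤ (half z - 1ℚ) + (half z' - 1ℚ)
rounding-keeps-≤ {z} {z'} c x y (D , c+2≡D) r r' c≤x+y = +-cancelʳ-≤ (1ℚ + 1ℚ) (begin
  c + (1ℚ + 1ℚ)                                 ≡⟨ c+2≡D ⟩
  fromℕ D                                       ≤⟨ halfRounding-half-≥ D r r' D≤ ⟩
  half z + half z'                              ≡⟨ [a-1]+[b-1]+2≡a+b (half z) (half z') ⟨
  ((half z - 1ℚ) + (half z' - 1ℚ)) + (1ℚ + 1ℚ)  ∎)
  where
  open ≤-Reasoning
  D≤ : fromℕ D ≤ (x + 1ℚ) + (y + 1ℚ)
  D≤ = begin
    fromℕ D                  ≡⟨ c+2≡D ⟨
    c + (1ℚ + 1ℚ)            ≤⟨ +-monoˡ-≤ (1ℚ + 1ℚ) c≤x+y ⟩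
    (x + y) + (1ℚ + 1ℚ)      ≡⟨ x+y+2≡[x+1]+[y+1] x y ⟩
    (x + 1ℚ) + (y + 1ℚ)      ∎

rounding-keeps-≡ : ∀ {z z'} c x y → ∃[ D ] c + (1ℚ + 1ℚ) ≡ fromℕ D →
                   HalfRounding (x + 1ℚ) z → HalfRounding (y + 1ℚ) z' →
                   c ≡ x + y → c ≡ (half z - 1ℚ) + (half z' - 1ℚ)
rounding-keeps-≡ {z} {z'} c x y (D , c+2≡D) r r' c≡x+y = +-cancelʳ-≡ (1ℚ + 1ℚ) (begin
  c + (1ℚ + 1ℚ)                                 ≡⟨ c+2≡D ⟩
  fromℕ D                                       ≡⟨ halfRounding-half-≡ D r r' x+y+2≡D ⟨
  half z + half z'                              ≡⟨ [a-1]+[b-1]+2≡a+b (half z) (half z') ⟨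
  ((half z - 1ℚ) + (half z' - 1ℚ)) + (1ℚ + 1ℚ)  ∎)
  where
  open ≡-Reasoning
  x+y+2≡D : (x + 1ℚ) + (y + 1ℚ) ≡ fromℕ D
  x+y+2≡D = begin
    (x + 1ℚ) + (y + 1ℚ)      ≡⟨ x+y+2≡[x+1]+[y+1] x y ⟨
    (x + y) + (1ℚ + 1ℚ)      ≡⟨ cong (_+ (1ℚ + 1ℚ)) c≡x+y ⟨
    c + (1ℚ + 1ℚ)            ≡⟨ c+2≡D ⟩
    fromℕ D                  ∎

IsMinOfStarTrees-resp : ∀ {n r} {M : Matrix n} {vs ws : Fin r → Fin n → ℚ} → (∀ k i → vs k i ≡ ws k i) →
                        IsMinOfStarTrees M r vs → IsMinOfStarTrees M r ws
IsMinOfStarTrees-resp {M = M} vs≡ws h i j i≢j =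
  (λ k → subst (M i j ≤_) (cong₂ _+_ (vs≡ws k i) (vs≡ws k j)) (proj₁ (h i j i≢j) k)) ,
  (let k , tight = proj₂ (h i j i≢j) in k , trans tight (cong₂ _+_ (vs≡ws k i) (vs≡ws k j)))

isMinOfStarTrees? : ∀ {n} (M : Matrix n) r vs → Dec (IsMinOfStarTrees M r vs)
isMinOfStarTrees? M r vs =
  all? λ i → all? λ j → ¬? (i ≟ᶠ j) →-dec
    ((all? λ k → M i j ≤? vs k i + vs k j) ×-dec (any? λ k → M i j ≟ vs k i + vs k j))

grid : Fin 8 → ℚ
grid q = half (toℕ q) - 1ℚ

decodeGrid : ∀ {n r} → (Fin r → Fin (8 ℕ.^ n)) → Fin r → Fin n → ℚ
decodeGrid f k i = grid (finToFun (f k) i)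

Feasible : ∀ {n} → Matrix n → (Fin n → ℚ) → Set
Feasible {n} M v = ∀ (i j : Fin n) → i ≢ j → M i j ≤ v i + v j

KeepsTight : ∀ {n} → Matrix n → (Fin n → ℚ) → (Fin n → ℚ) → Set
KeepsTight {n} M v w = ∀ (i j : Fin n) → i ≢ j → M i j ≡ v i + v j → M i j ≡ w i + w j

AgreesOrSlack : ∀ {n} → (Fin n → ℚ) → (Fin n → ℚ) → Set
AgreesOrSlack {n} v w =
  ∀ (i j : Fin n) → i ≢ j → (w i + w j ≡ v i + v j) ⊎ (1ℚ < v i + v j × 1ℚ ≤ w i + w j)

module ZeroOne {n} {M : Matrix n} (zo : IsZeroOne M) where

  entry-≤1 : ∀ {i j} → i ≢ j → M i j ≤ 1ℚ
  entry-≤1 {i} {j} i≢j with zo i j i≢j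
  ... | inj₁ Mij≡0 = subst (_≤ 1ℚ) (sym Mij≡0) (from-yes (0ℚ ≤? 1ℚ))
  ... | inj₂ Mij≡1 = ≤-reflexive Mij≡1

  entry-nonNeg : ∀ {i j} → i ≢ j → 0ℚ ≤ M i j
  entry-nonNeg {i} {j} i≢j with zo i j i≢j
  ... | inj₁ Mij≡0 = ≤-reflexive (sym Mij≡0)
  ... | inj₂ Mij≡1 = subst (0ℚ ≤_) (sym Mij≡1) (from-yes (0ℚ ≤? 1ℚ))

  entry+2-natural : ∀ {i j} → i ≢ j → ∃[ D ] M i j + (1ℚ + 1ℚ) ≡ fromℕ D
  entry+2-natural {i} {j} i≢j with zo i j i≢j
  ... | inj₁ Mij≡0 = 2 , cong (_+ (1ℚ + 1ℚ)) Mij≡0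
  ... | inj₂ Mij≡1 = 3 , cong (_+ (1ℚ + 1ℚ)) Mij≡1

  agreesOrSlack⇒ : ∀ {v w} → AgreesOrSlack v w → Feasible M v → Feasible M w × KeepsTight M v w
  agreesOrSlack⇒ {v} {w} aos fv = feasible , keepsTight
    where
    feasible : Feasible M w
    feasible i j i≢j with aos i j i≢j
    ... | inj₁ same      = subst (M i j ≤_) (sym same) (fv i j i≢j)
    ... | inj₂ (_ , 1≤w) = ≤-trans (entry-≤1 i≢j) 1≤w
    keepsTight : KeepsTight M v w
    keepsTight i j i≢j tight with aos i j i≢j
    ... | inj₁ same      = trans tight (sym same)
    ... | inj₂ (1<v , _) = ⊥-elim (<-irrefl tight (≤-<-trans (entry-≤1 i≢j) 1<v))

  feasible⇒neg-≤ : ∀ {v i c} → Feasible M v → i ≢ c → - v c ≤ v i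
  feasible⇒neg-≤ {v} {i} {c} fv i≢c = 0≤p+q⇒-q≤p (v i) (v c) (≤-trans (entry-nonNeg i≢c) (fv i c i≢c))

  entry≤0⇒≡0 : ∀ {i j} → i ≢ j → M i j ≤ 0ℚ → M i j ≡ 0ℚ
  entry≤0⇒≡0 i≢j Mij≤0 = ≤-antisym Mij≤0 (entry-nonNeg i≢j)

  raiseMinimum : ∀ v → Feasible M v → ∃[ w ] (AgreesOrSlack v w × (∀ i → - 1ℚ ≤ w i))
  raiseMinimum v fv with any? (λ c → v c <? - 1ℚ)
  ... | no ∄ = v , (λ _ _ _ → inj₁ refl) , (λ i → ≮⇒≥ (λ vi<-1 → ∄ (i , vi<-1)))
  ... | yes (c , vc<-1) = w , agreesOrSlack , bounded
    where
    -- All entries other than v c exceed 1, so moving t from each of them to c keeps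
    -- the sums through c and leaves all other pairs slack.
    t : ℚ
    t = - v c - 1ℚ

    w : Fin n → ℚ
    w i with i ≟ᶠ c
    ... | yes _ = - 1ℚ
    ... | no _  = v i - t

    1<v : ∀ {i} → i ≢ c → 1ℚ < v i
    1<v i≢c = <-≤-trans (neg-antimono-< vc<-1) (feasible⇒neg-≤ {v} fv i≢c)

    1≤v-t : ∀ {i} → i ≢ c → 1ℚ ≤ v i - t
    1≤v-t {i} i≢c = subst (_≤ v i - t) (one (v c)) (+-monoˡ-≤ (- t) (feasible⇒neg-≤ {v} fv i≢c))
      where
      one : ∀ x → - x - (- x - 1ℚ) ≡ 1ℚ
      one = solve 1 (λ x → :- x :- (:- x :- con 1ℚ) := con 1ℚ) refl

    agreesOrSlack : AgreesOrSlack v w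
    agreesOrSlack i j i≢j with i ≟ᶠ c | j ≟ᶠ c
    ... | yes i≡c | yes j≡c = ⊥-elim (i≢j (trans i≡c (sym j≡c)))
    ... | yes refl | no _ = inj₁ (sum-at-c (v c) (v j))
      where
      sum-at-c : ∀ x y → - 1ℚ + (y - (- x - 1ℚ)) ≡ x + y
      sum-at-c = solve 2 (λ x y → :- con 1ℚ :+ (y :- (:- x :- con 1ℚ)) := x :+ y) refl
    ... | no _ | yes refl = inj₁ (sum-at-c (v c) (v i))
      where
      sum-at-c : ∀ x y → (y - (- x - 1ℚ)) + - 1ℚ ≡ y + x
      sum-at-c = solve 2 (λ x y → (y :- (:- x :- con 1ℚ)) :+ :- con 1ℚ := y :+ x) refl
    ... | no i≢c | no j≢c =
      inj₂ (+-mono-< (1<v i≢c) (<-trans (positive⁻¹ 1ℚ) (1<v j≢c)) ,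
            +-mono-≤ (1≤v-t i≢c) (≤-trans (from-yes (0ℚ ≤? 1ℚ)) (1≤v-t j≢c)))

    bounded : ∀ i → - 1ℚ ≤ w i
    bounded i with i ≟ᶠ c
    ... | yes _   = ≤-refl
    ... | no i≢c  = ≤-trans (from-yes (- 1ℚ ≤? 1ℚ)) (1≤v-t i≢c)

  module _ (v : Fin n → ℚ) (-1≤v : ∀ i → - 1ℚ ≤ v i) where

    capped : Fin n → ℚ
    capped i = v i ⊓ (1ℚ + 1ℚ)

    capped-bounded : ∀ i → - 1ℚ ≤ capped i × capped i ≤ 1ℚ + 1ℚ
    capped-bounded i = ⊓-glb (-1≤v i) (from-yes (- 1ℚ ≤? 1ℚ + 1ℚ)) , p⊓q≤q (v i) (1ℚ + 1ℚ)

    capped-slack : ∀ i j → v i ≰ 1ℚ + 1ℚ → 1ℚ < v i + v j × 1ℚ ≤ capped i + capped j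
    capped-slack i j vi≰2 =
      +-mono-<-≤ (≰⇒> vi≰2) (-1≤v j) ,
      +-mono-≤ (≤-reflexive (sym (p≥q⇒p⊓q≡q (<⇒≤ (≰⇒> vi≰2))))) (proj₁ (capped-bounded j))

    capped-agreesOrSlack : AgreesOrSlack v capped
    capped-agreesOrSlack i j i≢j with v i ≤? 1ℚ + 1ℚ | v j ≤? 1ℚ + 1ℚ
    ... | yes vi≤2 | yes vj≤2 = inj₁ (cong₂ _+_ (p≤q⇒p⊓q≡p vi≤2) (p≤q⇒p⊓q≡p vj≤2))
    ... | no vi≰2  | _        = inj₂ (capped-slack i j vi≰2)
    ... | yes _    | no vj≰2  =
      inj₂ (subst₂ (λ x y → 1ℚ < x × 1ℚ ≤ y) (+-comm (v j) (v i)) (+-comm (capped j) (capped i))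
                   (capped-slack j i vj≰2))

  roundToGrid : ∀ v → Feasible M v → (∀ i → - 1ℚ ≤ v i × v i ≤ 1ℚ + 1ℚ) →
                ∃[ q ] (Feasible M (λ i → grid (q i)) × KeepsTight M v (λ i → grid (q i)))
  roundToGrid v fv bounded = q , feasible , keepsTight
    where
    rounding : ∀ i → ∃[ z ] (z ℕ.< 8 × HalfRounding (v i + 1ℚ) z)
    rounding i = halfRounding 4 (+-monoˡ-≤ 1ℚ (proj₁ (bounded i)))
                   (≤-<-trans (+-monoˡ-≤ 1ℚ (proj₂ (bounded i))) (from-yes ((1ℚ + 1ℚ) + 1ℚ <? fromℕ 4)))

    halfRounded : ∀ i → HalfRounding (v i + 1ℚ) (proj₁ (rounding i))
    halfRounded i = proj₂ (proj₂ (rounding i))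

    q : Fin n → Fin 8
    q i = fromℕ< (proj₁ (proj₂ (rounding i)))

    grid-q : ∀ i → half (proj₁ (rounding i)) - 1ℚ ≡ grid (q i)
    grid-q i = cong (λ a → half a - 1ℚ) (sym (toℕ-fromℕ< (proj₁ (proj₂ (rounding i)))))

    feasible : Feasible M (λ i → grid (q i))
    feasible i j i≢j = subst (M i j ≤_) (cong₂ _+_ (grid-q i) (grid-q j))
      (rounding-keeps-≤ (M i j) (v i) (v j) (entry+2-natural i≢j) (halfRounded i) (halfRounded j) (fv i j i≢j))

    keepsTight : KeepsTight M v (λ i → grid (q i))
    keepsTight i j i≢j tight = trans
      (rounding-keeps-≡ (M i j) (v i) (v j) (entry+2-natural i≢j) (halfRounded i) (halfRounded j) tight)
      (cong₂ _+_ (grid-q i) (grid-q j))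

  normalize : ∀ v → Feasible M v →
              ∃[ q ] (Feasible M (λ i → grid (q i)) × KeepsTight M v (λ i → grid (q i)))
  normalize v fv =
    let w , v≈w , -1≤w = raiseMinimum v fv
        fw , v→w       = agreesOrSlack⇒ {v} {w} v≈w fv
        fc , w→c       = agreesOrSlack⇒ {w} {capped w -1≤w} (capped-agreesOrSlack w -1≤w) fw
        q , fq , c→q   = roundToGrid (capped w -1≤w) fc (capped-bounded w -1≤w)
    in q , fq , λ i j i≢j → c→q i j i≢j ∘ w→c i j i≢j ∘ v→w i j i≢j

  starMin-onGrid : ∀ {r} → IsStarMin M r → ∃[ q ] IsMinOfStarTrees M r (λ k i → grid (q k i))
  starMin-onGrid (vs , h) = (λ k → proj₁ (normalized k)) , λ i j i≢j →
    (λ k → proj₁ (proj₂ (normalized k)) i j i≢j) ,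
    (let k , tight = proj₂ (h i j i≢j) in k , proj₂ (proj₂ (normalized k)) i j i≢j tight)
    where
    normalized : ∀ k → ∃[ q ] (Feasible M (λ i → grid (q i)) × KeepsTight M (vs k) (λ i → grid (q i)))
    normalized k = normalize (vs k) (λ i j i≢j → proj₁ (h i j i≢j) k)

  isStarMin? : ∀ r → Dec (IsStarMin M r)
  isStarMin? r with anyFunction? (isMinOfStarTrees? M r ∘ decodeGrid)
                      (λ f≗g → IsMinOfStarTrees-resp (λ k i → cong (λ c → grid (finToFun c i)) (f≗g k)))
  ... | yes (f , h) = yes (decodeGrid f , h)
  ... | no ∄ = no λ starMin → let q , h = starMin-onGrid starMin in
    ∄ ((λ k → funToFin (q k)) , IsMinOfStarTrees-resp (λ k i → cong grid (sym (finToFun-funToFin (q k) i))) h)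

  memberOf : (Fin n → ℚ) → Member n
  memberOf v with any? (λ c → v c <? 0ℚ)
  ... | yes (c , _) = star c (subsetOf (λ l → v l ≟ - v c))
  ... | no _        = clique (subsetOf (λ i → v i ≟ 0ℚ))

  memberOf-valid : ∀ {v} → Feasible M v → ValidMember M (memberOf v)
  memberOf-valid {v} fv with any? (λ c → v c <? 0ℚ)
  ... | yes (c , vc<0) = c∉L , λ l l∈L → let c≢l = λ c≡l → c∉L (subst (_∈ L) (sym c≡l) l∈L) in
        c≢l , entry≤0⇒≡0 c≢l (subst (M c l ≤_) (trans (cong (v c +_) (∈-subsetOf⁻ L? l∈L)) (+-inverseʳ (v c)))
                                 (fv c l c≢l))
    where
    L? : Decidable (λ l → v l ≡ - v c)
    L? l = v l ≟ - v c
    L : Subset n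
    L = subsetOf L?
    c∉L : c ∉ L
    c∉L c∈L = <-irrefl (∈-subsetOf⁻ L? c∈L) (<-trans vc<0 (neg-antimono-< vc<0))
  ... | no _ = λ i j i∈C j∈C i≢j → i≢j , entry≤0⇒≡0 i≢j
        (subst (M i j ≤_) (cong₂ _+_ (∈-subsetOf⁻ C? i∈C) (∈-subsetOf⁻ C? j∈C)) (fv i j i≢j))
    where
    C? : Decidable (λ i → v i ≡ 0ℚ)
    C? i = v i ≟ 0ℚ

  memberOf-covers : ∀ {v i j} → Feasible M v → i ≢ j → v i + v j ≡ 0ℚ → CoversEdge (memberOf v) i j
  memberOf-covers {v} {i} {j} fv i≢j sum≡0 with any? (λ c → v c <? 0ℚ)
  ... | yes (c , vc<0) = centered (i ≟ᶠ c) (j ≟ᶠ c)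
    where
    L? : Decidable (λ l → v l ≡ - v c)
    L? l = v l ≟ - v c
    0<v : ∀ {x} → x ≢ c → 0ℚ < v x
    0<v x≢c = <-≤-trans (neg-antimono-< vc<0) (feasible⇒neg-≤ fv x≢c)
    centered : Dec (i ≡ c) → Dec (j ≡ c) → CoversEdge (star c (subsetOf L?)) i j
    centered (yes refl) _ = inj₁ (refl , ∈-subsetOf⁺ L? (p+q≡0⇒q≡-p (v i) (v j) sum≡0))
    centered (no _) (yes refl) =
      inj₂ (refl , ∈-subsetOf⁺ L? (p+q≡0⇒q≡-p (v j) (v i) (trans (+-comm (v j) (v i)) sum≡0)))
    centered (no i≢c) (no j≢c) = ⊥-elim (<-irrefl (sym sum≡0) (+-mono-< (0<v i≢c) (0<v j≢c)))
  ... | no ∄ = ∈-subsetOf⁺ C? (nonNeg-+-≡0⇒≡0 (0≤v i) (0≤v j) sum≡0) ,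
               ∈-subsetOf⁺ C? (nonNeg-+-≡0⇒≡0 (0≤v j) (0≤v i) (trans (+-comm (v j) (v i)) sum≡0))
    where
    C? : Decidable (λ i → v i ≡ 0ℚ)
    C? i = v i ≟ 0ℚ
    0≤v : ∀ x → 0ℚ ≤ v x
    0≤v x = ≮⇒≥ (λ vx<0 → ∄ (x , vx<0))

  starMin⇒edgeCover : ∀ {r} → IsStarMin M r → ∃[ F ] EdgeCover M r F
  starMin⇒edgeCover (vs , h) = (λ k → memberOf (vs k)) , (λ k → memberOf-valid (fv k)) , covers
    where
    fv : ∀ k → Feasible M (vs k)
    fv k i j i≢j = proj₁ (h i j i≢j) k
    covers : ∀ i j → Edge M i j → ∃[ k ] CoversEdge (memberOf (vs k)) i j
    covers i j (i≢j , Mij≡0) = let k , tight = proj₂ (h i j i≢j) in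
      k , memberOf-covers (fv k) i≢j (trans (sym tight) Mij≡0)

  covers⇒zero : ∀ {m i j} → IsSymmetric M → ValidMember M m → i ≢ j → CoversEdge m i j → M i j ≡ 0ℚ
  covers⇒zero {clique C} {i} {j} _ valid i≢j (i∈C , j∈C) = proj₂ (valid i j i∈C j∈C i≢j)
  covers⇒zero {star c L} _ (_ , edges) _ (inj₁ (refl , j∈L)) = proj₂ (edges _ j∈L)
  covers⇒zero {star c L} {i} {j} symM (_ , edges) i≢j (inj₂ (refl , i∈L)) =
    trans (symM i j i≢j) (proj₂ (edges i i∈L))

  memberVec-feasible : ∀ {m} → IsSymmetric M → ValidMember M m → Feasible M (memberVec m)
  memberVec-feasible {m} symM valid i j i≢j with memberVec-≥1 i≢j m
  ... | inj₁ cov = ≤-reflexive (trans (covers⇒zero symM valid i≢j cov) (sym (memberVec-covers i≢j m cov)))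
  ... | inj₂ 1≤  = ≤-trans (entry-≤1 i≢j) 1≤

  edgeCover⇒starMin-suc : ∀ {r F} → IsSymmetric M → EdgeCover M r F → IsStarMin M (suc r)
  edgeCover⇒starMin-suc {r} {F} symM (valid , cover) = vs , λ i j i≢j → feasible i j i≢j , tight i j i≢j
    where
    vs : Fin (suc r) → Fin n → ℚ
    vs Fin.zero    _ = ½
    vs (Fin.suc k)   = memberVec (F k)
    feasible : ∀ i j → i ≢ j → ∀ k → M i j ≤ vs k i + vs k j
    feasible i j i≢j Fin.zero    = entry-≤1 i≢j
    feasible i j i≢j (Fin.suc k) = memberVec-feasible symM (valid k) i j i≢j
    tight : ∀ i j → i ≢ j → ∃[ k ] M i j ≡ vs k i + vs k j
    tight i j i≢j with zo i j i≢j
    ... | inj₁ Mij≡0 = let k , cov = cover i j (i≢j , Mij≡0) in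
                       Fin.suc k , trans Mij≡0 (sym (memberVec-covers i≢j (F k) cov))
    ... | inj₂ Mij≡1 = Fin.zero , Mij≡1

  solidCover⇒starMin : ∀ {r F} → IsSymmetric M → EdgeCover M r F → IsSolid M r F → IsStarMin M r
  solidCover⇒starMin {r} {F} symM (valid , cover) solid =
    (λ k → memberVec (F k)) , λ i j i≢j → (λ k → memberVec-feasible symM (valid k) i j i≢j) , tight i j i≢j
    where
    tight : ∀ i j → i ≢ j → ∃[ k ] M i j ≡ memberVec (F k) i + memberVec (F k) j
    tight i j i≢j with zo i j i≢j | solidAt solid i≢j
    ... | inj₁ Mij≡0 | _ = let k , cov = cover i j (i≢j , Mij≡0) in
                           k , trans Mij≡0 (sym (memberVec-covers i≢j (F k) cov))
    ... | inj₂ Mij≡1 | inj₁ (_ , Mij≡0) = ⊥-elim (1≢0 (trans (sym Mij≡1) Mij≡0))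
    ... | inj₂ Mij≡1 | inj₂ (k , solidifies) with memberVec-solid i≢j (F k) solidifies
    ...   | inj₁ cov  = ⊥-elim (1≢0 (trans (sym Mij≡1) (covers⇒zero symM (valid k) i≢j cov)))
    ...   | inj₂ sum≡1 = k , trans Mij≡1 (sym sum≡1)

proposition4p4 : ∀ (n : ℕ) (M : Matrix n) → IsSymmetric M → IsZeroOne M →
    ∀ (r : ℕ) → MinCoverNumber M r →
      (StarTreeRank M r ⊎ StarTreeRank M (suc r)) ×
      ((∃[ F ] (EdgeCover M r F × IsSolid M r F)) → StarTreeRank M r)
proposition4p4 n M symM zo r ((_ , cover) , minimal) = rankIsROrSucR , solid⇒rankIsR
  where
  open ZeroOne zo

  rankBound : ∀ r' → IsStarMin M r' → r ℕ.≤ r'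
  rankBound r' starMin = let F' , cover' = starMin⇒edgeCover starMin in minimal r' F' cover'

  rankIsROrSucR : StarTreeRank M r ⊎ StarTreeRank M (suc r)
  rankIsROrSucR with isStarMin? r
  ... | yes starMin = inj₁ (starMin , rankBound)
  ... | no ¬starMin = inj₂ (edgeCover⇒starMin-suc symM cover ,
          λ r' starMin' → ℕ.≤∧≢⇒< (rankBound r' starMin') (λ { refl → ¬starMin starMin' }))

  solid⇒rankIsR : (∃[ F ] (EdgeCover M r F × IsSolid M r F)) → StarTreeRank M r
  solid⇒rankIsR (_ , cover' , solid) = solidCover⇒starMin symM cover' solid , rankBound
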